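{- Let $X=[x_{ij}]$ be an $n\times n$ doubly stochastic matrix, and let $u_i,v_i,u'_i,v'_i$ ($1\le i\le n$) be real numbers such that \[ u_i+v_j\le x_{ij}\le u'_i+v'_j\quad\text{for all }(i,j)\notin\xi(X). \] Then \[ \mathrm{DW}(X)\le\sum_i (u'_i-u_i)+\sum_j (v'_j-v_j). \]
   Context: A square nonnegative matrix is doubly stochastic if all row and column sums equal $1$. $\xi(X)$ is the set of positions of the zero entries of $X$. For an $n\times n$ permutation matrix $P$, $d^X_P=\sum_{i,j}p_{ij}x_{ij}$. Let $\mathcal P_n$ be the set of $n\times n$ permutation matrices. The diagonal width of $X$ is $\mathrm{DW}(X)=\max\{d^X_P: P\in\mathcal P_n,\ \xi(X)\subseteq\xi(P)\}-\min\{d^X_Q: Q\in\mathcal P_n,\ \xi(X)\subseteq\xi(Q)\}$. -}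

module Defs where

open import Level using (Level; _⊔_) renaming (suc to lsuc)
open import Data.Nat using (ℕ; zero; suc)
open import Data.Fin using (Fin; zero; suc; _≟_)
open import Data.Fin.Permutation using (Permutation′; _⟨$⟩ʳ_)
open import Data.Product using (∃; _×_)
open import Relation.Nullary using (¬_; yes; no)
open import Algebra.Structures using (IsCommutativeRing)
open import Relation.Binary.Structures using (IsTotalOrder)

-- An ordered field (the real numbers ℝ are an instance).  agda-stdlib has
-- no reals and no ordered-algebra hierarchy, so the standard axioms are
-- spelled out here.
record OrderedField (c ℓ₁ ℓ₂ : Level) : Set (lsuc (c ⊔ ℓ₁ ⊔ ℓ₂)) where
  infix  4 _≈_ _≤_
  infixl 6 _+_ _-_
  infixl 7 _*_
  field
    Carrier : Set c
    _≈_     : Carrier → Carrier → Set ℓ₁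
    _≤_     : Carrier → Carrier → Set ℓ₂
    _+_     : Carrier → Carrier → Carrier
    _*_     : Carrier → Carrier → Carrier
    -_      : Carrier → Carrier
    0#      : Carrier
    1#      : Carrier
    isCommutativeRing : IsCommutativeRing _≈_ _+_ _*_ -_ 0# 1#
    0≉1     : ¬ (0# ≈ 1#)
    inverse : ∀ x → ¬ (x ≈ 0#) → ∃ λ y → x * y ≈ 1#
    isTotalOrder : IsTotalOrder _≈_ _≤_
    +-monoˡ-≤ : ∀ {x y} z → x ≤ y → x + z ≤ y + z
    *-nonneg  : ∀ {x y} → 0# ≤ x → 0# ≤ y → 0# ≤ x * y

  _-_ : Carrier → Carrier → Carrier
  x - y = x + (- y)

  Σ : ∀ {n} → (Fin n → Carrier) → Carrier
  Σ {zero}  f = 0#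
  Σ {suc n} f = f zero + Σ (λ i → f (suc i))

  Matrix : ℕ → Set c
  Matrix n = Fin n → Fin n → Carrier

  DoublyStochastic : ∀ {n} → Matrix n → Set (ℓ₁ ⊔ ℓ₂)
  DoublyStochastic {n} X =
    (∀ i j → 0# ≤ X i j) ×
    (∀ i → Σ (λ j → X i j) ≈ 1#) ×
    (∀ j → Σ (λ i → X i j) ≈ 1#)

  permMatrix : ∀ {n} → Permutation′ n → Matrix n
  permMatrix σ i j with (σ ⟨$⟩ʳ i) ≟ j
  ... | yes _ = 1#
  ... | no  _ = 0#

  -- ξ(X) ⊆ ξ(Y): every zero position of X is a zero position of Y
  ZerosIncluded : ∀ {n} → Matrix n → Matrix n → Set ℓ₁
  ZerosIncluded X Y = ∀ i j → X i j ≈ 0# → Y i j ≈ 0#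

  d : ∀ {n} → Matrix n → Permutation′ n → Carrier
  d X σ = Σ (λ i → Σ (λ j → permMatrix σ i j * X i j))

  -- DW(X) ≤ b, where DW(X) = max{d^X_P : ξ(X) ⊆ ξ(P)} - min{d^X_Q : ξ(X) ⊆ ξ(Q)}:
  -- unfolded as  d^X_P - d^X_Q ≤ b  for all admissible P, Q.
  DW≤ : ∀ {n} → Matrix n → Carrier → Set (ℓ₁ ⊔ ℓ₂)
  DW≤ {n} X b = ∀ (σ τ : Permutation′ n) →
    ZerosIncluded X (permMatrix σ) → ZerosIncluded X (permMatrix τ) →
    d X σ - d X τ ≤ b

-- For a permutation σ with ξ(X) ⊆ ξ(P_σ), every entry X i σ(i) is nonzero, so the bounds
-- u i + v σ(i) ≤ X i σ(i) ≤ u′ i + v′ σ(i) apply along the whole diagonal of σ. Summing over i,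
-- and using that σ merely reorders the columns, gives Σ u + Σ v ≤ d^X_σ ≤ Σ u′ + Σ v′ for every
-- admissible σ; subtracting the lower bound for τ from the upper bound for σ bounds DW(X).
module Submission where

open import Defs
open import Level using (Level)
open import Data.Nat using (ℕ; zero; suc)
open import Data.Fin using (Fin; zero; suc; _≟_)
open import Data.Fin.Properties using (suc-injective)
open import Data.Fin.Permutation using (Permutation′; _⟨$⟩ʳ_)
open import Data.Product using (_×_; proj₁; proj₂)
open import Data.Empty using (⊥-elim)
open import Function using (_∘_)
open import Relation.Nullary using (¬_; yes; no)
open import Relation.Binary.PropositionalEquality using (_≡_; _≢_; cong)
import Relation.Binary.PropositionalEquality as ≡
open import Relation.Binary.Structures using (IsTotalOrder)
open import Algebra.Bundles using (CommutativeRing)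
import Algebra.Properties.Semiring.Sum as SemiringSum
import Algebra.Properties.Ring as RingProperties
import Algebra.Properties.Group as GroupProperties
import Algebra.Properties.AbelianGroup as AbelianGroupProperties
import Algebra.Properties.CommutativeSemigroup as CommutativeSemigroupProperties

module OrderedFieldProperties {c ℓ₁ ℓ₂ : Level} (F : OrderedField c ℓ₁ ℓ₂) where
  open OrderedField F

  commutativeRing : CommutativeRing c ℓ₁
  commutativeRing = record { isCommutativeRing = isCommutativeRing }

  open CommutativeRing commutativeRing
    using ( setoid; refl; sym; trans; reflexive; +-cong; +-congˡ; +-comm; +-identityˡ; +-identityʳ
          ; *-congʳ; *-identityˡ; zeroˡ; semiring; ring; +-group; +-abelianGroup; +-commutativeSemigroup)
  open SemiringSum semiring using (sum; sum-cong-≋; sum-replicate-zero; ∑-distrib-+; ∑-permute; *-distribˡ-sum)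
  open RingProperties ring using (-1*x≈-x)
  open GroupProperties +-group using (\\-leftDividesˡ)
  open AbelianGroupProperties +-abelianGroup using (⁻¹-∙-comm)
  open CommutativeSemigroupProperties +-commutativeSemigroup using (interchange)
  open IsTotalOrder isTotalOrder using (≤-respˡ-≈; ≤-respʳ-≈) renaming (refl to ≤-refl; trans to ≤-trans)
  open import Relation.Binary.Reasoning.Setoid setoid

  Σ≡sum : ∀ {n} (f : Fin n → Carrier) → Σ f ≡ sum f
  Σ≡sum {zero}  f = ≡.refl
  Σ≡sum {suc n} f = cong (f zero +_) (Σ≡sum (λ i → f (suc i)))

  Σ-cong : ∀ {n} {f g : Fin n → Carrier} → (∀ i → f i ≈ g i) → Σ f ≈ Σ g
  Σ-cong {f = f} {g} f≈g rewrite Σ≡sum f | Σ≡sum g = sum-cong-≋ f≈g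

  Σ-distrib-+ : ∀ {n} (f g : Fin n → Carrier) → Σ (λ i → f i + g i) ≈ Σ f + Σ g
  Σ-distrib-+ f g rewrite Σ≡sum (λ i → f i + g i) | Σ≡sum f | Σ≡sum g = ∑-distrib-+ f g

  Σ-permute : ∀ {n} (f : Fin n → Carrier) (σ : Permutation′ n) → Σ (λ i → f (σ ⟨$⟩ʳ i)) ≈ Σ f
  Σ-permute f σ rewrite Σ≡sum (λ i → f (σ ⟨$⟩ʳ i)) | Σ≡sum f = sym (∑-permute f σ)

  Σ-distrib-neg : ∀ {n} (f : Fin n → Carrier) → Σ (λ i → - f i) ≈ - Σ f
  Σ-distrib-neg f = begin
    Σ (λ i → - f i)        ≈⟨ Σ-cong (λ i → sym (-1*x≈-x (f i))) ⟩
    Σ (λ i → - 1# * f i)   ≈⟨ reflexive (Σ≡sum (λ i → - 1# * f i)) ⟩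
    sum (λ i → - 1# * f i) ≈⟨ *-distribˡ-sum (- 1#) f ⟨
    - 1# * sum f           ≈⟨ -1*x≈-x (sum f) ⟩
    - sum f                ≈⟨ reflexive (cong -_ (Σ≡sum f)) ⟨
    - Σ f                  ∎

  Σ-distrib-sub : ∀ {n} (f g : Fin n → Carrier) → Σ (λ i → f i - g i) ≈ Σ f - Σ g
  Σ-distrib-sub f g = trans (Σ-distrib-+ f (λ i → - g i)) (+-congˡ (Σ-distrib-neg g))

  Σ-zero : ∀ n → Σ {n} (λ _ → 0#) ≈ 0#
  Σ-zero n rewrite Σ≡sum {n} (λ _ → 0#) = sum-replicate-zero n

  Σ-select : ∀ {n} (f : Fin n → Carrier) (k : Fin n) → (∀ j → j ≢ k → f j ≈ 0#) → Σ f ≈ f k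
  Σ-select {suc n} f zero    f≈0 =
    trans (+-congˡ (trans (Σ-cong (λ j → f≈0 (suc j) λ ())) (Σ-zero n))) (+-identityʳ _)
  Σ-select {suc n} f (suc k) f≈0 =
    trans (+-cong (f≈0 zero λ ()) (Σ-select (λ j → f (suc j)) k λ j j≢k → f≈0 (suc j) (j≢k ∘ suc-injective)))
          (+-identityˡ _)

  +-monoʳ-≤ : ∀ {x y} z → x ≤ y → z + x ≤ z + y
  +-monoʳ-≤ {x} {y} z x≤y = ≤-respʳ-≈ (+-comm y z) (≤-respˡ-≈ (+-comm x z) (+-monoˡ-≤ z x≤y))

  +-mono-≤ : ∀ {x y z w} → x ≤ y → z ≤ w → x + z ≤ y + w
  +-mono-≤ {y = y} {z} x≤y z≤w = ≤-trans (+-monoˡ-≤ z x≤y) (+-monoʳ-≤ y z≤w)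

  Σ-mono : ∀ {n} {f g : Fin n → Carrier} → (∀ i → f i ≤ g i) → Σ f ≤ Σ g
  Σ-mono {zero}  f≤g = ≤-refl
  Σ-mono {suc n} f≤g = +-mono-≤ (f≤g zero) (Σ-mono λ i → f≤g (suc i))

  -‿antitone : ∀ {x y} → x ≤ y → - y ≤ - x
  -‿antitone {x} {y} x≤y =
    ≤-respʳ-≈ (trans (+-congˡ (+-comm (- x) (- y))) (\\-leftDividesˡ y (- x)))
              (≤-respˡ-≈ (\\-leftDividesˡ x (- y)) (+-monoˡ-≤ (- x + - y) x≤y))

  sub-mono-≤ : ∀ {x y z w} → x ≤ y → z ≤ w → x - w ≤ y - z
  sub-mono-≤ x≤y z≤w = +-mono-≤ x≤y (-‿antitone z≤w)

  +-sub-interchange : ∀ x y z w → (x + y) - (z + w) ≈ (x - z) + (y - w)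
  +-sub-interchange x y z w = trans (+-congˡ (sym (⁻¹-∙-comm z w))) (interchange x y (- z) (- w))

  permMatrix-≡ : ∀ {n} (σ : Permutation′ n) i j → σ ⟨$⟩ʳ i ≡ j → permMatrix σ i j ≈ 1#
  permMatrix-≡ σ i j σi≡j with (σ ⟨$⟩ʳ i) ≟ j
  ... | yes _     = refl
  ... | no σi≢j = ⊥-elim (σi≢j σi≡j)

  permMatrix-≢ : ∀ {n} (σ : Permutation′ n) i j → σ ⟨$⟩ʳ i ≢ j → permMatrix σ i j ≈ 0#
  permMatrix-≢ σ i j σi≢j with (σ ⟨$⟩ʳ i) ≟ j
  ... | yes σi≡j = ⊥-elim (σi≢j σi≡j)
  ... | no _     = refl

  d≈Σ-diagonal : ∀ {n} (X : Matrix n) σ → d X σ ≈ Σ (λ i → X i (σ ⟨$⟩ʳ i))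
  d≈Σ-diagonal X σ = Σ-cong λ i →
    trans (Σ-select _ (σ ⟨$⟩ʳ i) λ j j≢σi →
             trans (*-congʳ (permMatrix-≢ σ i j λ σi≡j → j≢σi (≡.sym σi≡j))) (zeroˡ _))
          (trans (*-congʳ (permMatrix-≡ σ i _ ≡.refl)) (*-identityˡ _))

  admissible⇒diagonal≉0 : ∀ {n} (X : Matrix n) σ → ZerosIncluded X (permMatrix σ) →
                          ∀ i → ¬ (X i (σ ⟨$⟩ʳ i) ≈ 0#)
  admissible⇒diagonal≉0 X σ ξX⊆ξP i Xiσi≈0 =
    0≉1 (trans (sym (ξX⊆ξP i _ Xiσi≈0)) (permMatrix-≡ σ i _ ≡.refl))

  Σ-+-permuteʳ : ∀ {n} (u v : Fin n → Carrier) (σ : Permutation′ n) →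
                 Σ (λ i → u i + v (σ ⟨$⟩ʳ i)) ≈ Σ u + Σ v
  Σ-+-permuteʳ u v σ = trans (Σ-distrib-+ u _) (+-congˡ (Σ-permute v σ))

  d≤Σ-upper : ∀ {n} (X : Matrix n) (u′ v′ : Fin n → Carrier) →
              (∀ i j → ¬ (X i j ≈ 0#) → X i j ≤ u′ i + v′ j) →
              ∀ σ → ZerosIncluded X (permMatrix σ) → d X σ ≤ Σ u′ + Σ v′
  d≤Σ-upper X u′ v′ X≤ σ ξX⊆ξP =
    ≤-respˡ-≈ (sym (d≈Σ-diagonal X σ)) (≤-respʳ-≈ (Σ-+-permuteʳ u′ v′ σ)
      (Σ-mono λ i → X≤ i _ (admissible⇒diagonal≉0 X σ ξX⊆ξP i)))

  Σ-lower≤d : ∀ {n} (X : Matrix n) (u v : Fin n → Carrier) →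
              (∀ i j → ¬ (X i j ≈ 0#) → u i + v j ≤ X i j) →
              ∀ σ → ZerosIncluded X (permMatrix σ) → Σ u + Σ v ≤ d X σ
  Σ-lower≤d X u v ≤X σ ξX⊆ξP =
    ≤-respʳ-≈ (sym (d≈Σ-diagonal X σ)) (≤-respˡ-≈ (Σ-+-permuteʳ u v σ)
      (Σ-mono λ i → ≤X i _ (admissible⇒diagonal≉0 X σ ξX⊆ξP i)))

corollary6p2 : ∀ {c ℓ₁ ℓ₂ : Level} (F : OrderedField c ℓ₁ ℓ₂) → let open OrderedField F in
    ∀ (n : ℕ) (X : Matrix n) → DoublyStochastic X →
    ∀ (u v u′ v′ : Fin n → Carrier) →
    (∀ i j → ¬ (X i j ≈ 0#) → (u i + v j ≤ X i j) × (X i j ≤ u′ i + v′ j)) →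
    DW≤ X (Σ (λ i → u′ i - u i) + Σ (λ j → v′ j - v j))
corollary6p2 F n X _ u v u′ v′ bounds σ τ ξX⊆ξPσ ξX⊆ξPτ =
  ≤-respʳ-≈ width≈
    (sub-mono-≤ (d≤Σ-upper X u′ v′ (λ i j nz → proj₂ (bounds i j nz)) σ ξX⊆ξPσ)
                (Σ-lower≤d X u v (λ i j nz → proj₁ (bounds i j nz)) τ ξX⊆ξPτ))
  where
  open OrderedField F
  open OrderedFieldProperties F
  open CommutativeRing commutativeRing using (sym; trans; +-cong)
  open IsTotalOrder isTotalOrder using (≤-respʳ-≈)

  width≈ : (Σ u′ + Σ v′) - (Σ u + Σ v) ≈ Σ (λ i → u′ i - u i) + Σ (λ j → v′ j - v j)
  width≈ = trans (+-sub-interchange (Σ u′) (Σ v′) (Σ u) (Σ v))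
                 (sym (+-cong (Σ-distrib-sub u′ u) (Σ-distrib-sub v′ v)))
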